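{- Let $M=\langle Q,(A_q)_{q\in Q},(\delta_e)_{e\in E}\rangle$ be an MEMDP in revealed form. The common end-components of $M$ are exactly the end-components of the MDP $\bigcup_{e\in E}M[e]$.
   Context: An MDP is $\langle Q,(A_q)_{q\in Q},\delta\rangle$ with $\delta(q,a)$ a probability distribution on $Q$ for $a\in A_q$. An end-component of an MDP is a pair $(Q',(A'_q)_{q\in Q'})$ with $Q'\subseteq Q$, nonempty $A'_q\subseteq A_q$, $\Supp(\delta(q,a))\subseteq Q'$ for all $q\in Q'$, $a\in A'_q$, and such that the graph on $Q'$ with edges $(q,q')$ whenever $\delta(q,a)(q')>0$ for some $a\in A'_q$ is strongly connected. An MEMDP over environments $E$ is $M=\langle Q,(A_q),(\delta_e)_{e\in E}\rangle$ with each $M[e]=\langle Q,(A_q),\delta_e\rangle$ an MDP. A common end-component of $M$ is a pair that is an end-component of $M[e]$ for every $e\in E$. $\bigcup_{e\in E}M[e]$ is the MDP $\langle Q,(A_q),\delta_\cup\rangle$ where $\delta_\cup(q,a)$ is the uniform distribution over $\bigcup_{e\in E}\Supp(\delta_e(q,a))$. A transition $(q,a,q')$ is revealing if $\{e\in E\mid \delta_e(q,a)(q')>0\}$ is a strict subset of $E$; $M$ is in revealed form if for every revealing transition $(q,a,q')$ the state $q'$ is a sink in all environments ($\delta_e(q',b)(q')=1$ for all $e\in E$, $b\in A_{q'}$). -}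

module Defs where

open import Data.Nat as ℕ using (ℕ; zero; suc)
open import Data.Integer using (+_)
open import Data.Fin using (Fin; zero; suc)
open import Data.Fin.Subset using (Subset; _∈_; Nonempty)
open import Data.Rational using (ℚ; 0ℚ; 1ℚ; _+_; _≤_; _<_; _/_)
open import Data.Rational.Properties using (_<?_)
open import Data.Bool using (Bool; true; false; if_then_else_)
open import Data.Product using (Σ; ∃; _×_; _,_)
open import Relation.Nullary using (¬_; does)
open import Relation.Binary.PropositionalEquality using (_≡_)
open import Relation.Binary.Construct.Closure.ReflexiveTransitive using (Star)

sumFin : (n : ℕ) → (Fin n → ℚ) → ℚ
sumFin zero    f = 0ℚ
sumFin (suc n) f = f zero + sumFin n (λ i → f (suc i))

countFin : (n : ℕ) → (Fin n → Bool) → ℕ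
countFin zero    f = 0
countFin (suc n) f = (if f zero then 1 else 0) ℕ.+ countFin n (λ i → f (suc i))

IsDist : (n : ℕ) → (Fin n → ℚ) → Set
IsDist n p = (∀ i → 0ℚ ≤ p i) × sumFin n p ≡ 1ℚ

record MDP : Set where
  field
    nQ : ℕ
    nA : Fin nQ → ℕ
    δ  : (q : Fin nQ) → Fin (nA q) → Fin nQ → ℚ

open MDP public

IsMDP : MDP → Set
IsMDP M = ∀ q (a : Fin (nA M q)) → IsDist (nQ M) (δ M q a)

Edge : (M : MDP) → Subset (nQ M) → ((q : Fin (nQ M)) → Subset (nA M q))
     → Fin (nQ M) → Fin (nQ M) → Set
Edge M Q' A' q q' =
  q ∈ Q' × q' ∈ Q' × Σ (Fin (nA M q)) (λ a → a ∈ A' q × 0ℚ < δ M q a q')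

IsEC : (M : MDP) → Subset (nQ M) → ((q : Fin (nQ M)) → Subset (nA M q)) → Set
IsEC M Q' A' =
    (∀ q → q ∈ Q' → Nonempty (A' q))
  × (∀ q → q ∈ Q' → ∀ a → a ∈ A' q → ∀ q' → 0ℚ < δ M q a q' → q' ∈ Q')
  × (∀ q q' → q ∈ Q' → q' ∈ Q' → Star (Edge M Q' A') q q')

record MEMDP : Set where
  field
    nQ : ℕ
    nA : Fin nQ → ℕ
    nE : ℕ
    δ  : Fin nE → (q : Fin nQ) → Fin (nA q) → Fin nQ → ℚ

module ME = MEMDP

_[_] : (M : MEMDP) → Fin (ME.nE M) → MDP
M [ e ] = record { nQ = ME.nQ M ; nA = ME.nA M ; δ = ME.δ M e }

IsMEMDP : MEMDP → Set
IsMEMDP M = ∀ e → IsMDP (M [ e ])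

IsCommonEC : (M : MEMDP) → Subset (ME.nQ M) → ((q : Fin (ME.nQ M)) → Subset (ME.nA M q)) → Set
IsCommonEC M Q' A' = ∀ e → IsEC (M [ e ]) Q' A'

isPos : ℕ → Bool
isPos zero = false
isPos (suc _) = true

inUnionSupp : (M : MEMDP) → (q : Fin (ME.nQ M)) → Fin (ME.nA M q) → Fin (ME.nQ M) → Bool
inUnionSupp M q a q' = isPos (countFin (ME.nE M) (λ e → does (0ℚ <? ME.δ M e q a q')))

-- uniform distribution over ⋃_e Supp(δ_e(q,a)) (value 0 everywhere if that set is empty,
-- which never happens when E is nonempty and every δ_e(q,a) is a distribution)
unionδ : (M : MEMDP) → (q : Fin (ME.nQ M)) → Fin (ME.nA M q) → Fin (ME.nQ M) → ℚ
unionδ M q a q' with countFin (ME.nQ M) (inUnionSupp M q a)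
... | zero  = 0ℚ
... | suc k = if inUnionSupp M q a q' then (+ 1) / suc k else 0ℚ

⋃M : MEMDP → MDP
⋃M M = record { nQ = ME.nQ M ; nA = ME.nA M ; δ = unionδ M }

IsRevealing : (M : MEMDP) → (q : Fin (ME.nQ M)) → Fin (ME.nA M q) → Fin (ME.nQ M) → Set
IsRevealing M q a q' =
  (∃ λ e → 0ℚ < ME.δ M e q a q') × (∃ λ e → ¬ (0ℚ < ME.δ M e q a q'))

IsSink : (M : MEMDP) → Fin (ME.nQ M) → Set
IsSink M q' = ∀ e (b : Fin (ME.nA M q')) → ME.δ M e q' b q' ≡ 1ℚ

RevealedForm : MEMDP → Set
RevealedForm M = ∀ q a q' → IsRevealing M q a q' → IsSink M q'

{-# OPTIONS --safe #-}
-- An edge of the union that some environment e lacks is revealing, so its target z is a sink;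
-- in an end-component of the union z must still reach the source q, and a sink reaches only
-- itself, so q = z and δ_e(q,a)(q) = 1 > 0 after all. Hence an end-component of the union has
-- the same edges in every environment, while closure under actions transfers in both directions
-- because the support of the union is the union of the supports.
module Submission where

open import Defs
open import Data.Nat using (_<_)
open import Data.Fin using (Fin)
open import Data.Fin.Subset using (Subset)
open import Function.Bundles using (_⇔_)

open import Data.Bool using (Bool; true; false)
open import Data.Bool.Properties using (T-≡)
open import Data.Fin using (zero; suc; fromℕ<; _≟_)
open import Data.Fin.Subset using (_∈_)
open import Data.Integer using (+_)
open import Data.Nat using (ℕ; zero; suc)
open import Data.Product using (∃; _,_; proj₁; proj₂; map₂)
open import Data.Rational using (ℚ; 0ℚ; 1ℚ; _+_; _≤_; _/_)
  renaming (_<_ to _<ℚ_)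
open import Data.Rational.Properties
  using (_<?_; ≤-refl; ≤-trans; +-mono-≤; +-monoˡ-≤; +-monoʳ-≤; +-monoʳ-<; +-comm;
         +-identityˡ; +-identityʳ; <-irrefl; positive⁻¹; normalize-pos; module ≤-Reasoning)
open import Function using (_∘_; Equivalence; mk⇔)
open import Level using (Level)
open import Relation.Binary.Core using (Rel)
open import Relation.Binary.Construct.Closure.ReflexiveTransitive using (Star; ε; _◅_)
import Relation.Binary.Construct.Closure.ReflexiveTransitive as Star
open import Relation.Binary.PropositionalEquality using (_≡_; _≢_; refl; sym; trans; cong; subst)
open import Relation.Nullary using (does; yes; no; contradiction)
open import Relation.Nullary.Decidable using (dec-true; toWitness; isYes≗does)

private
  variable
    a ℓ : Level
    A : Set a
    n : ℕ

nonNeg⇒q≤p+q : ∀ {p} q → 0ℚ ≤ p → q ≤ p + q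
nonNeg⇒q≤p+q {p} q 0≤p = subst (_≤ p + q) (+-identityˡ q) (+-monoˡ-≤ q 0≤p)

nonNeg⇒p≤p+q : ∀ p {q} → 0ℚ ≤ q → p ≤ p + q
nonNeg⇒p≤p+q p {q} 0≤q = subst (_≤ p + q) (+-identityʳ p) (+-monoʳ-≤ p 0≤q)

sumFin-nonNeg : (f : Fin n → ℚ) → (∀ i → 0ℚ ≤ f i) → 0ℚ ≤ sumFin n f
sumFin-nonNeg {zero}  f f≥0 = ≤-refl
sumFin-nonNeg {suc n} f f≥0 = +-mono-≤ (f≥0 zero) (sumFin-nonNeg (f ∘ suc) (f≥0 ∘ suc))

term≤sumFin : (f : Fin n → ℚ) → (∀ i → 0ℚ ≤ f i) → ∀ i → f i ≤ sumFin n f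
term≤sumFin f f≥0 zero    = nonNeg⇒p≤p+q (f zero) (sumFin-nonNeg (f ∘ suc) (f≥0 ∘ suc))
term≤sumFin f f≥0 (suc i) =
  ≤-trans (term≤sumFin (f ∘ suc) (f≥0 ∘ suc) i) (nonNeg⇒q≤p+q _ (f≥0 zero))

twoTerms≤sumFin : (f : Fin n → ℚ) → (∀ i → 0ℚ ≤ f i) → ∀ {i j} → i ≢ j → f i + f j ≤ sumFin n f
twoTerms≤sumFin f f≥0 {zero}  {zero}  i≢j = contradiction refl i≢j
twoTerms≤sumFin f f≥0 {zero}  {suc j} i≢j = +-monoʳ-≤ (f zero) (term≤sumFin (f ∘ suc) (f≥0 ∘ suc) j)
twoTerms≤sumFin f f≥0 {suc i} {zero}  i≢j =
  subst (_≤ sumFin _ f) (+-comm (f zero) (f (suc i)))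
        (+-monoʳ-≤ (f zero) (term≤sumFin (f ∘ suc) (f≥0 ∘ suc) i))
twoTerms≤sumFin f f≥0 {suc i} {suc j} i≢j =
  ≤-trans (twoTerms≤sumFin (f ∘ suc) (f≥0 ∘ suc) (i≢j ∘ cong suc)) (nonNeg⇒q≤p+q _ (f≥0 zero))

IsDist-pointMass : {p : Fin n → ℚ} → IsDist n p → ∀ {i j} → p i ≡ 1ℚ → 0ℚ <ℚ p j → j ≡ i
IsDist-pointMass {n} {p} (p≥0 , sum≡1) {i} {j} pᵢ≡1 pⱼ>0 with j ≟ i
... | yes j≡i = j≡i
... | no  j≢i = contradiction 1<1 (<-irrefl refl)
  where
  open ≤-Reasoning
  1<1 : 1ℚ <ℚ 1ℚ
  1<1 = begin-strict
    1ℚ + 0ℚ     <⟨ +-monoʳ-< 1ℚ pⱼ>0 ⟩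
    1ℚ + p j    ≡⟨ cong (_+ p j) pᵢ≡1 ⟨
    p i + p j   ≤⟨ twoTerms≤sumFin p p≥0 (j≢i ∘ sym) ⟩
    sumFin n p  ≡⟨ sum≡1 ⟩
    1ℚ          ∎

countFin-pos⇒∃ : (f : Fin n → Bool) → isPos (countFin n f) ≡ true → ∃ λ i → f i ≡ true
countFin-pos⇒∃ {suc n} f pos with f zero in f₀≡
... | true  = zero , f₀≡
... | false with i , fᵢ≡ ← countFin-pos⇒∃ (f ∘ suc) pos = suc i , fᵢ≡

∃⇒countFin-suc : (f : Fin n → Bool) → ∀ {i} → f i ≡ true → ∃ λ k → countFin n f ≡ suc k
∃⇒countFin-suc {suc n} f {zero}  f₀≡ rewrite f₀≡ = _ , refl
∃⇒countFin-suc {suc n} f {suc i} fᵢ≡ with f zero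
... | true  = _ , refl
... | false = ∃⇒countFin-suc (f ∘ suc) fᵢ≡

Star-from-trap : {R : Rel A ℓ} {x y : A} → (∀ {z} → R x z → z ≡ x) → Star R x y → y ≡ x
Star-from-trap trap ε = refl
Star-from-trap trap (r ◅ rs) with refl ← trap r = Star-from-trap trap rs

module _ (M : MEMDP) where

  δ-pos⇒inUnionSupp : ∀ {q b z} e → 0ℚ <ℚ ME.δ M e q b z → inUnionSupp M q b z ≡ true
  δ-pos⇒inUnionSupp {q} {b} {z} e pos
    with k , count≡ ← ∃⇒countFin-suc (λ e → does (0ℚ <? ME.δ M e q b z))
                                     (dec-true (0ℚ <? ME.δ M e q b z) pos)
    rewrite count≡ = refl

  inUnionSupp⇒δ-pos : ∀ {q b z} → inUnionSupp M q b z ≡ true → ∃ λ e → 0ℚ <ℚ ME.δ M e q b z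
  inUnionSupp⇒δ-pos {q} {b} {z} inSupp =
    map₂ (λ {e} posₑ → let pos? = 0ℚ <? ME.δ M e q b z in
                       toWitness {a? = pos?} (Equivalence.from T-≡ (trans (isYes≗does pos?) posₑ)))
         (countFin-pos⇒∃ (λ e → does (0ℚ <? ME.δ M e q b z)) inSupp)

  δ-pos⇒unionδ-pos : ∀ {q b z} e → 0ℚ <ℚ ME.δ M e q b z → 0ℚ <ℚ unionδ M q b z
  δ-pos⇒unionδ-pos {q} {b} {z} e pos
    with countFin (ME.nQ M) (inUnionSupp M q b)
       | ∃⇒countFin-suc (inUnionSupp M q b) (δ-pos⇒inUnionSupp e pos)
  ... | .(suc k) | k , refl rewrite δ-pos⇒inUnionSupp e pos =
    positive⁻¹ ((+ 1) / suc k) {{normalize-pos 1 (suc k)}}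

  unionδ-pos⇒δ-pos : ∀ {q b z} → 0ℚ <ℚ unionδ M q b z → ∃ λ e → 0ℚ <ℚ ME.δ M e q b z
  unionδ-pos⇒δ-pos {q} {b} {z} pos with countFin (ME.nQ M) (inUnionSupp M q b)
  ... | zero  = contradiction pos (<-irrefl refl)
  ... | suc k with inUnionSupp M q b z in inSupp
  ...   | false = contradiction pos (<-irrefl refl)
  ...   | true  = inUnionSupp⇒δ-pos inSupp

  sink-selfLoop : ∀ {s} → IsSink M s → ∀ e b → 0ℚ <ℚ ME.δ M e s b s
  sink-selfLoop sink e b = subst (0ℚ <ℚ_) (sym (sink e b)) (positive⁻¹ 1ℚ)

  sink-unionSuccessor : IsMEMDP M → ∀ {s b z} → IsSink M s → 0ℚ <ℚ unionδ M s b z → z ≡ s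
  sink-unionSuccessor wf {s} {b} sink pos with e , posₑ ← unionδ-pos⇒δ-pos pos =
    IsDist-pointMass (wf e s b) (sink e b) posₑ

  module _ {Q' : Subset (ME.nQ M)} {A' : (q : Fin (ME.nQ M)) → Subset (ME.nA M q)} where

    unionEC-transition-common : IsMEMDP M → RevealedForm M → IsEC (⋃M M) Q' A'
      → ∀ {q z} → q ∈ Q' → z ∈ Q' → ∀ {b} → 0ℚ <ℚ unionδ M q b z → ∀ e → 0ℚ <ℚ ME.δ M e q b z
    unionEC-transition-common wf rev (_ , _ , connected) {q} {z} q∈ z∈ {b} pos e
      with 0ℚ <? ME.δ M e q b z
    ... | yes posₑ = posₑ
    ... | no ¬posₑ = contradiction (selfLoop q≡z b) ¬posₑ
      where
      z-sink : IsSink M z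
      z-sink = rev q b z (unionδ-pos⇒δ-pos pos , e , ¬posₑ)
      q≡z : q ≡ z
      q≡z = Star-from-trap (λ (_ , _ , _ , _ , pos') → sink-unionSuccessor wf z-sink pos')
                           (connected z q z∈ q∈)
      selfLoop : q ≡ z → ∀ b → 0ℚ <ℚ ME.δ M e q b z
      selfLoop refl = sink-selfLoop z-sink e

    edge⇒unionEdge : ∀ {e q z} → Edge (M [ e ]) Q' A' q z → Edge (⋃M M) Q' A' q z
    edge⇒unionEdge {e} (q∈ , z∈ , b , b∈ , pos) = q∈ , z∈ , b , b∈ , δ-pos⇒unionδ-pos e pos

    commonEC⇒unionEC : 0 < ME.nE M → IsCommonEC M Q' A' → IsEC (⋃M M) Q' A'
    commonEC⇒unionEC nE>0 common =
        proj₁ (common e₀)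
      , (λ q q∈ b b∈ z pos → let e , posₑ = unionδ-pos⇒δ-pos pos in
                             proj₁ (proj₂ (common e)) q q∈ b b∈ z posₑ)
      , (λ q q' q∈ q'∈ → Star.map edge⇒unionEdge (proj₂ (proj₂ (common e₀)) q q' q∈ q'∈))
      where
      e₀ : Fin (ME.nE M)
      e₀ = fromℕ< nE>0

    unionEC⇒commonEC : IsMEMDP M → RevealedForm M → IsEC (⋃M M) Q' A' → IsCommonEC M Q' A'
    unionEC⇒commonEC wf rev ec@(actions , closed , connected) e =
        actions
      , (λ q q∈ b b∈ z posₑ → closed q q∈ b b∈ z (δ-pos⇒unionδ-pos e posₑ))
      , (λ q q' q∈ q'∈ → Star.map unionEdge⇒edge (connected q q' q∈ q'∈))
      where
      unionEdge⇒edge : ∀ {q z} → Edge (⋃M M) Q' A' q z → Edge (M [ e ]) Q' A' q z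
      unionEdge⇒edge (q∈ , z∈ , b , b∈ , pos) =
        q∈ , z∈ , b , b∈ , unionEC-transition-common wf rev ec q∈ z∈ pos e

lemma4 : (M : MEMDP) → IsMEMDP M → 0 < MEMDP.nE M → RevealedForm M
       → (Q' : Subset (MEMDP.nQ M)) (A' : (q : Fin (MEMDP.nQ M)) → Subset (MEMDP.nA M q))
       → IsCommonEC M Q' A' ⇔ IsEC (⋃M M) Q' A'
lemma4 M wf nE>0 rev Q' A' = mk⇔ (commonEC⇒unionEC M nE>0) (unionEC⇒commonEC M wf rev)
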